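{- The bipermutohedral fan $\Sigma_{E,E}$ satisfies: (1) the projections $\pi(z,w)=z$ and $\overline\pi(z,w)=w$ are morphisms of fans from $\Sigma_{E,E}$ to the permutohedral fan $\Sigma_E$; (2) the addition map $\mu(z,w)=z+w$ is a morphism of fans from $\Sigma_{E,E}$ to $\Gamma_E$.
   Context: $E=\{0,\ldots,n\}$, $n\ge1$; $\N_E=\mathbb R^E/\mathbb R(1,\ldots,1)$ with lattice $\mathbb Z^E/\mathbb Z(1,\ldots,1)$, $\N_{E,E}=\N_E\oplus\N_E$, points $(z,w)$. $\Sigma_E$ is the complete fan in $\N_E$ whose chambers are cut out by the hyperplanes $z_i=z_j$ ($i\ne j$). $\Gamma_E$ is the complete fan in $\N_E$ with cones $\mathrm{cone}\{\mathbf e_i\}_{i\in S}$ for proper subsets $S\subsetneq E$. Bipermutohedral fan: for $k\in E$ let $\mathscr C_k=\{(z,w):\min_i(z_i+w_i)=z_k+w_k\}$, with coordinates $Z_i=z_i-z_k$, $W_i=-w_i+w_k$; subdivide $\mathscr C_k$ by all hyperplanes $Z_a=Z_b$, $W_a=W_b$, $Z_a=W_b$ ($a,b\in E$); $\Sigma_{E,E}$ is the union of these subdivisions. A morphism of fans is an integral linear map sending each cone into some cone.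
   Formalization: The spaces $\N_E$ and $\N_{E,E}$ are taken over ℚ instead of ℝ, so the cones of $\Sigma_{E,E}$, $\Sigma_E$ and $\Gamma_E$ are sets of rational points. -}

module Defs where

open import Data.Nat using (ℕ; suc)
open import Data.Fin using (Fin)
open import Data.Fin.Subset using (Subset; _∈_; _∉_)
open import Data.Rational using (ℚ; 0ℚ; _+_; _-_; _≤_; _<_)
open import Data.Product using (_×_; _,_; ∃; ∃-syntax; Σ)
open import Relation.Binary.PropositionalEquality using (_≡_)

-- The ground set E = {0,…,n} is Fin (suc n).
-- Points of N_E are represented by vectors E → ℚ; N_E is the quotient by
-- the constant vectors.  All cone memberships below are invariant under
-- adding constants, so they are well defined on N_E.  (Rational points
-- suffice: all cones involved are rational polyhedral cones.)
Vect : ℕ → Set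
Vect n = Fin (suc n) → ℚ

-- Sign compatibility: b (value of a linear form at q) lies in the closed
-- side of the hyperplane prescribed by a (value of the same form at p).
Compat : ℚ → ℚ → Set
Compat a b = (a < 0ℚ → b ≤ 0ℚ) × (a ≡ 0ℚ → b ≡ 0ℚ) × (0ℚ < a → 0ℚ ≤ b)

-- Permutohedral fan Σ_E: the cone determined by a point p is the closure
-- of the cell of the arrangement {z_i = z_j} containing p.
PermCone : ℕ → Set
PermCone n = Vect n

_∈Σ_ : ∀ {n} → Vect n → PermCone n → Set
z ∈Σ p = ∀ i j → Compat (p i - p j) (z i - z j)

-- Fan Γ_E: cones cone{e_i : i ∈ S} for proper subsets S ⊊ E.
ProperSubset : ℕ → Set
ProperSubset n = Σ (Subset (suc n)) λ S → ∃[ j ] (j ∉ S)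

-- x ∈ cone{e_i}_{i∈S} in N_E: x ≡ Σ_{i∈S} λ_i e_i modulo constants, λ ≥ 0.
_∈Γ_ : ∀ {n} → Vect n → ProperSubset n → Set
_∈Γ_ {n} x (S , _) =
  Σ (Vect n) λ coef →
    (∀ (i : Fin (suc n)) → 0ℚ ≤ coef i)
    × (∀ (i : Fin (suc n)) → i ∉ S → coef i ≡ 0ℚ)
    × Σ ℚ (λ c → ∀ (i : Fin (suc n)) → x i ≡ coef i + c)

InC : ∀ {n} → Fin (suc n) → Vect n → Vect n → Set
InC k z w = ∀ i → z k + w k ≤ z i + w i

Zc : ∀ {n} → Fin (suc n) → Vect n → Vect n
Zc k z i = z i - z k

Wc : ∀ {n} → Fin (suc n) → Vect n → Vect n
Wc k w i = w k - w i

-- A cone of Σ_{E,E}: the closure of the cell of the subdivision of C_k by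
-- the hyperplanes Z_a = Z_b, W_a = W_b, Z_a = W_b containing a point p ∈ C_k.
record BiCone (n : ℕ) : Set where
  constructor bicone
  field
    k   : Fin (suc n)
    pz  : Vect n
    pw  : Vect n
    pin : InC k pz pw

_∈ΣΣ_ : ∀ {n} → (Vect n × Vect n) → BiCone n → Set
_∈ΣΣ_ {n} (z , w) (bicone k pz pw _) =
  InC k z w ×
  (∀ (a b : Fin (suc n)) →
     Compat (Zc k pz a - Zc k pz b) (Zc k z a - Zc k z b)
   × Compat (Wc k pw a - Wc k pw b) (Wc k w a - Wc k w b)
   × Compat (Zc k pz a - Wc k pw b) (Zc k z a - Wc k w b))

_⊕_ : ∀ {n} → Vect n → Vect n → Vect n
(z ⊕ w) i = z i + w i

-- On the piece C_k the bipermutohedral coordinates are Z = z - z_k and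
-- W = w_k - w, i.e. a translate of z and a reflected translate of w.  The
-- hyperplanes Z_a = Z_b and W_a = W_b are therefore exactly the hyperplanes
-- z_a = z_b and w_a = w_b, so every cone of Σ_{E,E} is mapped by π and π̄
-- into the permutohedral cone of the corresponding point.  For μ only the
-- definition of C_k matters: z + w attains its minimum at k, so modulo
-- constants it is a nonnegative combination of the e_i with i ≠ k.
module Submission where

open import Defs
open import Data.Nat using (ℕ; suc)
open import Data.Product using (_×_; _,_; ∃-syntax; proj₁; proj₂)
open import Data.Fin using (Fin)
open import Data.Fin.Subset using (⁅_⁆; ∁)
open import Data.Fin.Subset.Properties using (x∈⁅x⁆; x∉∁p⇒x∈p; x∈⁅y⁆⇒x≡y; x∈p⇒x∉∁p)
open import Data.Rational using (ℚ; 0ℚ; _+_; _-_; -_; _≤_)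
open import Data.Rational.Properties using (+-monoˡ-≤; +-inverseʳ)
open import Data.Rational.Solver using (module +-*-Solver)
open import Relation.Binary.PropositionalEquality using (_≡_; refl; subst)

open +-*-Solver

private
  variable
    n : ℕ

translate-diff : ∀ x y c → (x - c) - (y - c) ≡ x - y
translate-diff = solve 3 (λ x y c → (x :- c) :- (y :- c) := x :- y) refl

reflect-diff : ∀ x y c → (c - x) - (c - y) ≡ y - x
reflect-diff = solve 3 (λ x y c → (c :- x) :- (c :- y) := y :- x) refl

sub-add-cancel : ∀ x c → x ≡ (x - c) + c
sub-add-cancel = solve 2 (λ x c → x := (x :- c) :+ c) refl

p≤q⇒0≤q-p : ∀ {p q} → p ≤ q → 0ℚ ≤ q - p
p≤q⇒0≤q-p {p} {q} p≤q = subst (_≤ q - p) (+-inverseʳ p) (+-monoˡ-≤ (- p) p≤q)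

Compat-cong : ∀ {a a′ b b′} → a ≡ a′ → b ≡ b′ → Compat a b → Compat a′ b′
Compat-cong refl refl compat = compat

π-morphism : (σ : BiCone n) → ∃[ τ ] (∀ (z w : Vect n) → (z , w) ∈ΣΣ σ → z ∈Σ τ)
π-morphism (bicone k pz pw _) = pz , λ z w (_ , compat) i j →
  Compat-cong (translate-diff (pz i) (pz j) (pz k)) (translate-diff (z i) (z j) (z k))
    (proj₁ (compat i j))

-- W reverses the order of w, so the comparison of w_i with w_j is the
-- comparison of W_j with W_i.
π̄-morphism : (σ : BiCone n) → ∃[ τ ] (∀ (z w : Vect n) → (z , w) ∈ΣΣ σ → w ∈Σ τ)
π̄-morphism (bicone k pz pw _) = pw , λ z w (_ , compat) i j →
  Compat-cong (reflect-diff (pw j) (pw i) (pw k)) (reflect-diff (w j) (w i) (w k))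
    (proj₁ (proj₂ (compat j i)))

Γ-coneAvoiding : Fin (suc n) → ProperSubset n
Γ-coneAvoiding k = ∁ ⁅ k ⁆ , k , x∈p⇒x∉∁p (x∈⁅x⁆ k)

min-∈Γ-coneAvoiding : (x : Vect n) (k : Fin (suc n)) →
  (∀ i → x k ≤ x i) → x ∈Γ Γ-coneAvoiding k
min-∈Γ-coneAvoiding x k min-at-k =
  (λ i → x i - x k)
  , (λ i → p≤q⇒0≤q-p (min-at-k i))
  , (λ i i∉S → subst (λ j → x i - x j ≡ 0ℚ) (x∈⁅y⁆⇒x≡y k (x∉∁p⇒x∈p i∉S)) (+-inverseʳ (x i)))
  , x k , λ i → sub-add-cancel (x i) (x k)

μ-morphism : (σ : BiCone n) → ∃[ S ] (∀ (z w : Vect n) → (z , w) ∈ΣΣ σ → (z ⊕ w) ∈Γ S)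
μ-morphism (bicone k _ _ _) =
  Γ-coneAvoiding k , λ z w (inC , _) → min-∈Γ-coneAvoiding (z ⊕ w) k inC

proposition2p11 : (n : ℕ) →
    ((σ : BiCone n) → ∃[ τ ] (∀ (z w : Vect n) → (z , w) ∈ΣΣ σ → z ∈Σ τ))
    × ((σ : BiCone n) → ∃[ τ ] (∀ (z w : Vect n) → (z , w) ∈ΣΣ σ → w ∈Σ τ))
    × ((σ : BiCone n) → ∃[ S ] (∀ (z w : Vect n) → (z , w) ∈ΣΣ σ → (z ⊕ w) ∈Γ S))
proposition2p11 n = π-morphism , π̄-morphism , μ-morphism
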